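{- Let $\Gamma$ be a plane of $\mathrm{PG}(8,q^3)$ disjoint from $\mathrm{PG}(8,q)$ such that $\Gamma,\Gamma^q,\Gamma^{q^2}$ span $\mathrm{PG}(8,q^3)$. Call a point of $\mathrm{PG}(8,q^3)$ a T-point if it lies in one of $\Gamma,\Gamma^q,\Gamma^{q^2}$; a line of $\mathrm{PG}(8,q^3)$ a T-line if it meets two of $\Gamma,\Gamma^q,\Gamma^{q^2}$; and a plane of $\mathrm{PG}(8,q^3)$ a T-plane if it meets all three of $\Gamma,\Gamma^q,\Gamma^{q^2}$. Then two T-planes of $\mathrm{PG}(8,q^3)$ are either equal, or disjoint, or meet in a T-point, or meet in a T-line.
   Context: $q$ is a prime power and $\mathrm{PG}(8,q)$ is embedded in $\mathrm{PG}(8,q^3)$ in the natural way. For a point $X=(x_0,\ldots,x_8)$ of $\mathrm{PG}(8,q^3)$ write $X^q=(x_0^q,\ldots,x_8^q)$, and for a subspace $\Sigma$ write $\Sigma^q=\{X^q : X\in\Sigma\}$. (The planes $\langle X,X^q,X^{q^2}\rangle\cap\mathrm{PG}(8,q)$, $X\in\Gamma$, form a regular $2$-spread of $\mathrm{PG}(8,q)$ with transversal planes $\Gamma,\Gamma^q,\Gamma^{q^2}$.) -}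

module Defs where

open import Level using (Level; _⊔_)
open import Data.Nat using (ℕ; zero; suc; _^_; _≤_)
open import Data.Nat.Primality using (Prime)
open import Data.Fin using (Fin; zero; suc)
open import Data.Product using (Σ; ∃; ∃-syntax; _×_; _,_)
open import Data.Sum using (_⊎_)
open import Relation.Nullary using (¬_)
open import Relation.Binary.PropositionalEquality using (_≡_; _≢_)
import Relation.Binary.PropositionalEquality as ≡
open import Function.Bundles using (Bijection)
open import Algebra.Bundles using (CommutativeRing)

IsPrimePower : ℕ → Set
IsPrimePower q = ∃[ p ] ∃[ k ] (Prime p × 1 ≤ k × q ≡ p ^ k)

IsField : ∀ {c ℓ} → CommutativeRing c ℓ → Set (c ⊔ ℓ)
IsField R = ¬ (0# ≈ 1#) × (∀ x → ¬ (x ≈ 0#) → ∃[ y ] (x * y ≈ 1#))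
  where open CommutativeRing R

HasSize : ∀ {c ℓ} → CommutativeRing c ℓ → ℕ → Set (c ⊔ ℓ)
HasSize R n = Bijection (≡.setoid (Fin n)) (CommutativeRing.setoid R)

-- Projective geometry PG(8, F) over the ring R (intended: a field with q^3 elements),
-- with Frobenius x ↦ x^q.
module PG8 {c ℓ} (R : CommutativeRing c ℓ) (q : ℕ) where
  open CommutativeRing R hiding (zero)

  pow : Carrier → ℕ → Carrier
  pow x zero = 1#
  pow x (suc n) = x * pow x n

  -- vectors of F^9 (homogeneous coordinates of PG(8,F))
  V : Set c
  V = Fin 9 → Carrier

  _≈v_ : V → V → Set ℓ
  u ≈v w = ∀ i → u i ≈ w i

  0v : V
  0v _ = 0#

  _+v_ : V → V → V
  (u +v w) i = u i + w i

  _·v_ : Carrier → V → V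
  (a ·v u) i = a * u i

  NonZero : V → Set ℓ
  NonZero u = ∃[ i ] ¬ (u i ≈ 0#)

  lincomb : ∀ {k} → (Fin k → Carrier) → (Fin k → V) → V
  lincomb {zero} cs vs = 0v
  lincomb {suc k} cs vs = (cs zero ·v vs zero) +v lincomb (λ j → cs (suc j)) (λ j → vs (suc j))

  InSpan : ∀ {k} → (Fin k → V) → V → Set (c ⊔ ℓ)
  InSpan vs w = ∃[ cs ] (w ≈v lincomb cs vs)

  LinIndep : ∀ {k} → (Fin k → V) → Set (c ⊔ ℓ)
  LinIndep {k} vs = ∀ cs → lincomb cs vs ≈v 0v → ∀ j → cs j ≈ 0#

  -- a (projective) subspace of projective dimension k-1, given by k independent vectors
  record Subsp (k : ℕ) : Set (c ⊔ ℓ) where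
    constructor subsp
    field
      basis : Fin k → V
      indep : LinIndep basis

  Line : Set (c ⊔ ℓ)
  Line = Subsp 2

  Plane : Set (c ⊔ ℓ)
  Plane = Subsp 3

  -- vectors of a subspace (the points are the nonzero ones, up to scalars)
  _∈_ : ∀ {k} → V → Subsp k → Set (c ⊔ ℓ)
  w ∈ S = InSpan (Subsp.basis S) w

  frobⁿ : ℕ → V → V
  frobⁿ n u i = pow (u i) (q ^ n)

  Conj : ∀ {k} → ℕ → Subsp k → V → Set (c ⊔ ℓ)
  Conj n S w = ∃[ x ] (x ∈ S × w ≈v frobⁿ n x)

  -- points of PG(8,q): nonzero vectors with all coordinates in GF(q) = {x : x^q = x}
  SubgeomPoint : V → Set ℓ
  SubgeomPoint u = NonZero u × (∀ i → pow (u i) q ≈ u i)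

  DisjointFromSubgeom : ∀ {k} → Subsp k → Set (c ⊔ ℓ)
  DisjointFromSubgeom S = ∀ u → SubgeomPoint u → ¬ (u ∈ S)

  ConjugatesSpan : ∀ {k} → Subsp k → Set (c ⊔ ℓ)
  ConjugatesSpan S = ∀ v → ∃[ a ] ∃[ b ] ∃[ d ]
    (Conj 0 S a × Conj 1 S b × Conj 2 S d × v ≈v ((a +v b) +v d))

  Tr : Plane → Fin 3 → V → Set (c ⊔ ℓ)
  Tr Γ zero = Conj 0 Γ
  Tr Γ (suc zero) = Conj 1 Γ
  Tr Γ (suc (suc zero)) = Conj 2 Γ

  Meets : ∀ {k} → Subsp k → (V → Set (c ⊔ ℓ)) → Set (c ⊔ ℓ)
  Meets S T = ∃[ v ] (NonZero v × v ∈ S × T v)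

  TPoint : Plane → V → Set (c ⊔ ℓ)
  TPoint Γ v = NonZero v × ∃[ i ] Tr Γ i v

  TLine : Plane → Line → Set (c ⊔ ℓ)
  TLine Γ L = ∃[ i ] ∃[ j ] (i ≢ j × Meets L (Tr Γ i) × Meets L (Tr Γ j))

  TPlane : Plane → Plane → Set (c ⊔ ℓ)
  TPlane Γ P = ∀ i → Meets P (Tr Γ i)

  SameSubsp : ∀ {k m} → Subsp k → Subsp m → Set (c ⊔ ℓ)
  SameSubsp S T = ∀ v → (v ∈ S → v ∈ T) × (v ∈ T → v ∈ S)

  Disjoint : ∀ {k m} → Subsp k → Subsp m → Set (c ⊔ ℓ)
  Disjoint S T = ∀ v → v ∈ S → v ∈ T → v ≈v 0v

  IntersectionIs : ∀ {k m n} → Subsp k → Subsp m → Subsp n → Set (c ⊔ ℓ)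
  IntersectionIs S T U = ∀ v → ((v ∈ S × v ∈ T) → v ∈ U) × (v ∈ U → (v ∈ S × v ∈ T))

  pointOf : (p : V) → Fin 1 → V
  pointOf p _ = p

module Submission where

-- Write Γᵢ for Γ^(q^i). In characteristic p the map x ↦ x^q is additive, so Γᵢ is spanned by
-- the conjugates of a basis of Γ; as these nine vectors span F⁹ they are a basis, and
-- F⁹ = Γ₀ ⊕ Γ₁ ⊕ Γ₂. A T-plane P contains a point Xᵢ of each Γᵢ; the Xᵢ are independent by the
-- direct sum, so they span P. If v lies on two T-planes with such points Xᵢ and X′ᵢ, comparing the
-- Γᵢ-components of its two expansions shows that only the Xᵢ proportional to X′ᵢ occur. Hence
-- P ∩ P′ is spanned by the common points of the two triples: three of them (P = P′), none
-- (disjoint), one (a T-point) or two (a line meeting two of the Γᵢ, a T-line).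

open import Defs
open import Level using (_⊔_)
open import Algebra.Bundles using (CommutativeRing; CommutativeSemiring; CommutativeMonoid)
open import Data.Nat as ℕ using (ℕ; zero; suc; _^_; _!; _∸_; _≤_; _<_; nonTrivial⇒≢1)
import Data.Nat.Properties as ℕ
open import Data.Nat.Divisibility using (_∣_; divides; ∣1⇒≡1; ∣⇒≤; m∣m*n)
open import Data.Nat.Primality using (Prime; euclidsLemma; prime⇒nonTrivial; prime⇒nonZero)
open import Data.Nat.Combinatorics using (_C_; nCk≡n!/k![n-k]!; k![n∸k]!∣n!; nCn≡1)
open import Data.Nat.DivMod using (m/n*n≡m)
open import Data.Fin as Fin using (Fin; zero; suc; toℕ; fromℕ; _↑ˡ_; _↑ʳ_)
open import Data.Fin.Patterns using (0F; 1F; 2F)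
import Data.Fin.Properties as Fin
open import Data.Vec.Functional using (_∷_; []; _++_; removeAt; insertAt; updateAt)
open import Data.Product using (∃-syntax; _×_; _,_; proj₁; proj₂)
open import Data.Sum using (_⊎_; inj₁; inj₂)
open import Function.Base using (_∘_)
open import Function.Bundles using (Bijection)
open import Relation.Nullary using (¬_; Dec; yes; no; ¬?; contradiction)
open import Relation.Nullary.Decidable using (decidable-stable; map′)
open import Relation.Binary.PropositionalEquality as ≡ using (_≡_; _≢_)

prime∣n!⇒prime≤n : ∀ {p} → Prime p → ∀ n → p ∣ n ! → p ≤ n
prime∣n!⇒prime≤n p-prime zero p∣1 = contradiction (∣1⇒≡1 p∣1) (nonTrivial⇒≢1 {{prime⇒nonTrivial p-prime}})
prime∣n!⇒prime≤n p-prime (suc n) p∣[1+n]! with euclidsLemma (suc n) (n !) p-prime p∣[1+n]!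
... | inj₁ p∣1+n = ∣⇒≤ p∣1+n
... | inj₂ p∣n! = ℕ.m≤n⇒m≤1+n (prime∣n!⇒prime≤n p-prime n p∣n!)

prime∣pCk : ∀ {p k} → Prime p → 0 < k → k < p → p ∣ p C k
prime∣pCk {suc r} {k} p-prime 0<k k<p with euclidsLemma (suc r C k) (k ! ℕ.* (suc r ∸ k) !) p-prime p∣pCk*k![p∸k]!
  where
  pCk*k![p∸k]!≡p! : (suc r C k) ℕ.* (k ! ℕ.* (suc r ∸ k) !) ≡ suc r !
  pCk*k![p∸k]!≡p! = ≡.trans (≡.cong (ℕ._* (k ! ℕ.* (suc r ∸ k) !)) (nCk≡n!/k![n-k]! (ℕ.<⇒≤ k<p)))
                            (m/n*n≡m {{k ℕ.!* (suc r ∸ k) !≢0}} (k![n∸k]!∣n! (ℕ.<⇒≤ k<p)))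
  p∣pCk*k![p∸k]! : suc r ∣ (suc r C k) ℕ.* (k ! ℕ.* (suc r ∸ k) !)
  p∣pCk*k![p∸k]! = ≡.subst (suc r ∣_) (≡.sym pCk*k![p∸k]!≡p!) (m∣m*n (r !))
... | inj₁ p∣pCk = p∣pCk
... | inj₂ p∣k![p∸k]! with euclidsLemma (k !) ((suc r ∸ k) !) p-prime p∣k![p∸k]!
...   | inj₁ p∣k! = contradiction (prime∣n!⇒prime≤n p-prime k p∣k!) (ℕ.<⇒≱ k<p)
...   | inj₂ p∣[p∸k]! = contradiction (prime∣n!⇒prime≤n p-prime _ p∣[p∸k]!)
                                     (ℕ.<⇒≱ (ℕ.∸-monoʳ-< {o = 0} 0<k (ℕ.<⇒≤ k<p)))

module SumSupport {a ℓ} (M : CommutativeMonoid a ℓ) where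
  open CommutativeMonoid M renaming (_∙_ to _+_; ε to 0#; ∙-congˡ to +-congˡ)
  open import Algebra.Properties.CommutativeMonoid.Sum M
  open import Relation.Binary.Reasoning.Setoid setoid

  sum-≈0 : ∀ {n} {f : Fin n → Carrier} → (∀ i → f i ≈ 0#) → sum f ≈ 0#
  sum-≈0 {n} f≈0 = trans (sum-cong-≋ f≈0) (sum-replicate-zero n)

  sum-single : ∀ {n} (f : Fin n → Carrier) i → (∀ s → s ≢ i → f s ≈ 0#) → sum f ≈ f i
  sum-single {suc n} f i f≈0 = begin
    sum f                      ≈⟨ sum-remove f ⟩
    f i + sum (removeAt f i)   ≈⟨ +-congˡ (sum-≈0 (λ s → f≈0 _ (Fin.punchInᵢ≢i i s))) ⟩
    f i + 0#                   ≈⟨ identityʳ (f i) ⟩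
    f i                        ∎

  sum-pair : ∀ {n} (f : Fin n → Carrier) {i j} → i ≢ j →
             (∀ s → s ≢ i → s ≢ j → f s ≈ 0#) → sum f ≈ f i + f j
  sum-pair {suc n} f {i} {j} i≢j f≈0 = begin
    sum f                          ≈⟨ sum-remove f ⟩
    f i + sum (removeAt f i)       ≈⟨ +-congˡ (sum-single (removeAt f i) j′ removed≈0) ⟩
    f i + f (Fin.punchIn i j′)     ≡⟨ ≡.cong (λ t → f i + f t) (Fin.punchIn-punchOut i≢j) ⟩
    f i + f j                      ∎
    where
    j′ = Fin.punchOut i≢j
    removed≈0 : ∀ s → s ≢ j′ → removeAt f i s ≈ 0#
    removed≈0 s s≢j′ = f≈0 _ (Fin.punchInᵢ≢i i s) λ eq →
      s≢j′ (Fin.punchIn-injective i s j′ (≡.trans eq (≡.sym (Fin.punchIn-punchOut i≢j))))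

module Frobenius {a ℓ} (R : CommutativeSemiring a ℓ) {p} (p-prime : Prime p) where
  open CommutativeSemiring R hiding (zero)
  open import Relation.Binary.Reasoning.Setoid setoid
  open import Algebra.Properties.Semiring.Mult semiring
    using (×-homo-1; ×1-homo-*; ×-assoc-*; ×-congˡ; ×-congʳ) renaming (_×_ to _×ₘ_)
  open import Algebra.Properties.Semiring.Exp semiring using (^-congˡ; ^-assocʳ) renaming (_^_ to _^ʳ_)
  open import Algebra.Properties.CommutativeSemiring.Binomial R using (theorem; binomialTerm)
  open import Algebra.Properties.Semiring.Sum semiring using (sum)
  open SumSupport +-commutativeMonoid using (sum-pair)

  module _ (p×1≈0 : p ×ₘ 1# ≈ 0#) where

    p∣m⇒m×x≈0 : ∀ {m} x → p ∣ m → m ×ₘ x ≈ 0#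
    p∣m⇒m×x≈0 {m} x (divides t m≡t*p) = begin
      m ×ₘ x                          ≈⟨ ×-congˡ m≡t*p ⟩
      (t ℕ.* p) ×ₘ x                  ≈⟨ ×-congʳ (t ℕ.* p) (*-identityˡ x) ⟨
      (t ℕ.* p) ×ₘ (1# * x)           ≈⟨ ×-assoc-* (t ℕ.* p) 1# x ⟨
      ((t ℕ.* p) ×ₘ 1#) * x           ≈⟨ *-congʳ (×1-homo-* t p) ⟩
      ((t ×ₘ 1#) * (p ×ₘ 1#)) * x     ≈⟨ *-congʳ (*-congˡ p×1≈0) ⟩
      ((t ×ₘ 1#) * 0#) * x            ≈⟨ *-congʳ (zeroʳ _) ⟩
      0# * x                          ≈⟨ zeroˡ x ⟩
      0#                              ∎

    ^p-homo-+ : ∀ x y → (x + y) ^ʳ p ≈ x ^ʳ p + y ^ʳ p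
    ^p-homo-+ x y = begin
      (x + y) ^ʳ p                                           ≈⟨ theorem p x y ⟩
      sum (binomialTerm x y p)                               ≈⟨ sum-pair (binomialTerm x y p) fromℕ≢zero inner≈0 ⟩
      binomialTerm x y p (fromℕ p) + binomialTerm x y p zero ≈⟨ +-cong last (×-homo-1 _) ⟩
      x ^ʳ p * y ^ʳ (p ∸ p) + 1# * y ^ʳ p                    ≈⟨ +-cong (*-congˡ y^[p∸p]≈1) (*-identityˡ _) ⟩
      x ^ʳ p * 1# + y ^ʳ p                                   ≈⟨ +-congʳ (*-identityʳ _) ⟩
      x ^ʳ p + y ^ʳ p                                        ∎
      where
      y^[p∸p]≈1 : y ^ʳ (p ∸ p) ≈ 1#
      y^[p∸p]≈1 = reflexive (≡.cong (y ^ʳ_) (ℕ.n∸n≡0 p))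
      fromℕ≢zero : fromℕ p ≢ zero
      fromℕ≢zero eq = ℕ.≢-nonZero⁻¹ p {{prime⇒nonZero p-prime}}
                                    (≡.trans (≡.sym (Fin.toℕ-fromℕ p)) (≡.cong toℕ eq))
      inner≈0 : ∀ s → s ≢ fromℕ p → s ≢ zero → binomialTerm x y p s ≈ 0#
      inner≈0 zero _ s≢0 = contradiction ≡.refl s≢0
      inner≈0 (suc s) s≢p _ = p∣m⇒m×x≈0 _ (prime∣pCk p-prime (ℕ.s≤s ℕ.z≤n) 1+s<p)
        where
        1+s≢p : suc (toℕ s) ≢ p
        1+s≢p eq = s≢p (Fin.toℕ-injective (≡.trans eq (≡.sym (Fin.toℕ-fromℕ p))))
        1+s<p : suc (toℕ s) < p
        1+s<p = ℕ.≤∧≢⇒< (ℕ.s≤s⁻¹ (Fin.toℕ<n (suc s))) 1+s≢p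
      last : binomialTerm x y p (fromℕ p) ≈ x ^ʳ p * y ^ʳ (p ∸ p)
      last = begin
        binomialTerm x y p (fromℕ p)        ≡⟨ ≡.cong (λ k → (p C k) ×ₘ (x ^ʳ k * y ^ʳ (p ∸ k))) (Fin.toℕ-fromℕ p) ⟩
        (p C p) ×ₘ (x ^ʳ p * y ^ʳ (p ∸ p))  ≡⟨ ≡.cong (_×ₘ (x ^ʳ p * y ^ʳ (p ∸ p))) (nCn≡1 p) ⟩
        1 ×ₘ (x ^ʳ p * y ^ʳ (p ∸ p))        ≈⟨ ×-homo-1 _ ⟩
        x ^ʳ p * y ^ʳ (p ∸ p)               ∎

    ^pᵐ-homo-+ : ∀ m x y → (x + y) ^ʳ (p ^ m) ≈ x ^ʳ (p ^ m) + y ^ʳ (p ^ m)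
    ^pᵐ-homo-+ zero x y = distribʳ 1# x y
    ^pᵐ-homo-+ (suc m) x y = begin
      (x + y) ^ʳ (p ℕ.* e)             ≈⟨ ^[p*e] (x + y) ⟩
      ((x + y) ^ʳ e) ^ʳ p              ≈⟨ ^-congˡ p (^pᵐ-homo-+ m x y) ⟩
      (x ^ʳ e + y ^ʳ e) ^ʳ p           ≈⟨ ^p-homo-+ (x ^ʳ e) (y ^ʳ e) ⟩
      (x ^ʳ e) ^ʳ p + (y ^ʳ e) ^ʳ p    ≈⟨ +-cong (^[p*e] x) (^[p*e] y) ⟨
      x ^ʳ (p ℕ.* e) + y ^ʳ (p ℕ.* e)  ∎
      where
      e = p ^ m
      ^[p*e] : ∀ z → z ^ʳ (p ℕ.* e) ≈ (z ^ʳ e) ^ʳ p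
      ^[p*e] z = trans (reflexive (≡.cong (z ^ʳ_) (ℕ.*-comm p e))) (sym (^-assocʳ z e p))

module FiniteRing {a ℓ} (R : CommutativeRing a ℓ) {n} (size : HasSize R n) where
  open CommutativeRing R hiding (zero)
  open import Relation.Binary.Reasoning.Setoid setoid
  open import Algebra.Properties.Ring ring using (+-identityʳ-unique)
  open import Algebra.Properties.Group +-group using (//-rightDividesˡ; //-rightDividesʳ)
  open import Algebra.Properties.CommutativeMonoid.Sum +-commutativeMonoid
    using (sum; sum-permute; sum-cong-≋; ∑-distrib-+; sum-replicate)
  open import Algebra.Properties.Semiring.Mult semiring using () renaming (_×_ to _×ₘ_)
  open import Data.Fin.Permutation using (Permutation; permutation)
  open Bijection size using (injective; surjective) renaming (to to element)

  index : Carrier → Fin n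
  index x = proj₁ (surjective x)

  element-index : ∀ x → element (index x) ≈ x
  element-index x = proj₂ (surjective x) ≡.refl

  infix 4 _≟_
  _≟_ : (x y : Carrier) → Dec (x ≈ y)
  x ≟ y with index x Fin.≟ index y
  ... | yes ix≡iy = yes (begin
    x                  ≈⟨ element-index x ⟨
    element (index x)  ≡⟨ ≡.cong element ix≡iy ⟩
    element (index y)  ≈⟨ element-index y ⟩
    y                  ∎)
  ... | no ix≢iy = no λ x≈y → ix≢iy (injective (trans (element-index x) (trans x≈y (sym (element-index y)))))

  translation : Carrier → Permutation n n
  translation a = permutation (λ i → index (element i + a)) (λ i → index (element i - a))
    (λ i → injective (trans (element-index _) (trans (+-congʳ (element-index _)) (//-rightDividesˡ a _))))
    (λ i → injective (trans (element-index _) (trans (+-congʳ (element-index _)) (//-rightDividesʳ a _))))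

  -- Translating by 1# permutes the elements, so adding 1# to each term leaves their sum unchanged.
  n×1≈0 : n ×ₘ 1# ≈ 0#
  n×1≈0 = +-identityʳ-unique ∑x (n ×ₘ 1#) (begin
    ∑x + n ×ₘ 1#                                   ≈⟨ +-congˡ (sum-replicate n) ⟨
    ∑x + sum {n} (λ _ → 1#)                        ≈⟨ ∑-distrib-+ element (λ _ → 1#) ⟨
    sum (λ i → element i + 1#)                     ≈⟨ sum-cong-≋ (λ i → element-index (element i + 1#)) ⟨
    sum (λ i → element (index (element i + 1#)))   ≈⟨ sum-permute element (translation 1#) ⟨
    ∑x                                             ∎)
    where ∑x = sum element

module Field {a ℓ} (F : CommutativeRing a ℓ) (isField : IsField F) where
  open CommutativeRing F hiding (zero)
  open import Relation.Binary.Reasoning.Setoid setoid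

  0≉1 : ¬ 0# ≈ 1#
  0≉1 = proj₁ isField

  infix 8 _⁻¹⟨_⟩
  _⁻¹⟨_⟩ : ∀ x → ¬ x ≈ 0# → Carrier
  x ⁻¹⟨ x≉0 ⟩ = proj₁ (proj₂ isField x x≉0)

  *-inverseʳ : ∀ {x} (x≉0 : ¬ x ≈ 0#) → x * x ⁻¹⟨ x≉0 ⟩ ≈ 1#
  *-inverseʳ {x} x≉0 = proj₂ (proj₂ isField x x≉0)

  *-inverseˡ : ∀ {x} (x≉0 : ¬ x ≈ 0#) → x ⁻¹⟨ x≉0 ⟩ * x ≈ 1#
  *-inverseˡ {x} x≉0 = trans (*-comm _ x) (*-inverseʳ x≉0)

  a*x≈y⇒x≈a⁻¹*y : ∀ {a x y} (a≉0 : ¬ a ≈ 0#) → a * x ≈ y → x ≈ a ⁻¹⟨ a≉0 ⟩ * y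
  a*x≈y⇒x≈a⁻¹*y {a} {x} {y} a≉0 a*x≈y = begin
    x               ≈⟨ *-identityˡ x ⟨
    1# * x          ≈⟨ *-congʳ (*-inverseˡ a≉0) ⟨
    (a⁻¹ * a) * x   ≈⟨ *-assoc a⁻¹ a x ⟩
    a⁻¹ * (a * x)   ≈⟨ *-congˡ a*x≈y ⟩
    a⁻¹ * y         ∎
    where a⁻¹ = a ⁻¹⟨ a≉0 ⟩

  a*x≈0⇒x≈0 : ∀ {a x} → ¬ a ≈ 0# → a * x ≈ 0# → x ≈ 0#
  a*x≈0⇒x≈0 a≉0 a*x≈0 = trans (a*x≈y⇒x≈a⁻¹*y a≉0 a*x≈0) (zeroʳ _)

module FiniteField {a ℓ} (F : CommutativeRing a ℓ) (isField : IsField F) {n} (size : HasSize F n) where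
  open CommutativeRing F hiding (zero)
  open import Algebra.Properties.Semiring.Mult semiring using (×-homo-1; ×1-homo-*) renaming (_×_ to _×ₘ_)
  open FiniteRing F size public using (_≟_)
  open FiniteRing F size using (n×1≈0)
  open Field F isField

  pᵐ×1≈0⇒p×1≈0 : ∀ p m → (p ^ m) ×ₘ 1# ≈ 0# → p ×ₘ 1# ≈ 0#
  pᵐ×1≈0⇒p×1≈0 p zero 1≈0 = contradiction (sym (trans (sym (×-homo-1 1#)) 1≈0)) 0≉1
  pᵐ×1≈0⇒p×1≈0 p (suc m) pᵐ⁺¹×1≈0 = decidable-stable (p ×ₘ 1# ≟ 0#) λ p×1≉0 →
    p×1≉0 (pᵐ×1≈0⇒p×1≈0 p m (a*x≈0⇒x≈0 p×1≉0 (trans (sym (×1-homo-* p (p ^ m))) pᵐ⁺¹×1≈0)))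

  characteristic : ∀ {p m} → n ≡ p ^ m → p ×ₘ 1# ≈ 0#
  characteristic {p} {m} n≡pᵐ =
    pᵐ×1≈0⇒p×1≈0 p m (trans (reflexive (≡.cong (_×ₘ 1#) (≡.sym n≡pᵐ))) n×1≈0)

module Matrices {a ℓ} (F : CommutativeRing a ℓ) (isField : IsField F)
    (_≟_ : (x y : CommutativeRing.Carrier F) → Dec (CommutativeRing._≈_ F x y)) where
  open CommutativeRing F hiding (zero)
  open import Relation.Binary.Reasoning.Setoid setoid
  open import Algebra.Properties.Ring ring using (-‿+-comm; -0#≈0#; -‿distribˡ-*; x[y-z]≈xy-xz)
  open import Algebra.Properties.Semiring.Sum semiring
  open import Data.Vec.Functional.Properties using (insertAt-lookup; insertAt-punchIn)
  open SumSupport +-commutativeMonoid using (sum-≈0)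
  open Field F isField

  sum-neg : ∀ {n} (f : Fin n → Carrier) → ∑[ j < n ] (- f j) ≈ - sum f
  sum-neg {zero} f = sym -0#≈0#
  sum-neg {suc n} f = trans (+-congˡ (sum-neg (f ∘ suc))) (-‿+-comm _ _)

  *-∑-assoc : ∀ {k} d (c w : Fin k → Carrier) → d * ∑[ j < k ] (c j * w j) ≈ ∑[ j < k ] (d * c j * w j)
  *-∑-assoc d c w = trans (*-distribˡ-sum d (λ j → c j * w j)) (sum-cong-≋ (λ j → sym (*-assoc d (c j) (w j))))

  ∑-assoc : ∀ {k m} (c : Fin k → Carrier) (M : Fin k → Fin m → Carrier) (w : Fin m → Carrier) →
            ∑[ j < k ] (c j * ∑[ i < m ] (M j i * w i)) ≈ ∑[ i < m ] (∑[ j < k ] (c j * M j i) * w i)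
  ∑-assoc {k} {m} c M w = begin
    ∑[ j < k ] (c j * ∑[ i < m ] (M j i * w i))   ≈⟨ sum-cong-≋ (λ j → *-distribˡ-sum (c j) (λ i → M j i * w i)) ⟩
    ∑[ j < k ] ∑[ i < m ] (c j * (M j i * w i))   ≈⟨ ∑-comm (λ j i → c j * (M j i * w i)) ⟩
    ∑[ i < m ] ∑[ j < k ] (c j * (M j i * w i))   ≈⟨ sum-cong-≋ (λ i → sum-cong-≋ (λ j → *-assoc (c j) (M j i) (w i))) ⟨
    ∑[ i < m ] ∑[ j < k ] (c j * M j i * w i)     ≈⟨ sum-cong-≋ (λ i → *-distribʳ-sum (w i) (λ j → c j * M j i)) ⟨
    ∑[ i < m ] (∑[ j < k ] (c j * M j i) * w i)   ∎

  record Dependency {k n} (u : Fin k → Fin n → Carrier) : Set (a ⊔ ℓ) where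
    constructor dependency
    field
      coeff : Fin k → Carrier
      index : Fin k
      coeff≉0 : ¬ coeff index ≈ 0#
      relation : ∀ i → ∑[ j < k ] (coeff j * u j i) ≈ 0#

  zero-column⇒Dependency : ∀ {k n} (u : Fin (suc k) → Fin (suc n) → Carrier) → (∀ j → u j zero ≈ 0#) →
                           Dependency (λ j i → u (suc j) (suc i)) → Dependency u
  zero-column⇒Dependency {k} u u₀≈0 (dependency c j c≉0 rel) = dependency (0# ∷ c) (suc j) c≉0 relation
    where
    relation : ∀ i → ∑[ s < suc k ] ((0# ∷ c) s * u s i) ≈ 0#
    relation zero = begin
      0# * u zero zero + ∑[ s < k ] (c s * u (suc s) zero) ≈⟨ +-cong (zeroˡ _) (sum-≈0 λ s → trans (*-congˡ (u₀≈0 (suc s))) (zeroʳ _)) ⟩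
      0# + 0#                                              ≈⟨ +-identityˡ 0# ⟩
      0#                                                   ∎
    relation (suc i) = trans (+-cong (zeroˡ _) (rel i)) (+-identityˡ 0#)

  eliminate : ∀ {k n} (u : Fin (suc k) → Fin (suc n) → Carrier) {r} → ¬ u r zero ≈ 0# → Fin k → Fin n → Carrier
  eliminate u {r} pivot≉0 j i =
    u (Fin.punchIn r j) (suc i) - (u (Fin.punchIn r j) zero * u r zero ⁻¹⟨ pivot≉0 ⟩) * u r (suc i)

  pivot⇒Dependency : ∀ {k n} (u : Fin (suc k) → Fin (suc n) → Carrier) {r} (pivot≉0 : ¬ u r zero ≈ 0#) →
                     Dependency (eliminate u pivot≉0) → Dependency u
  pivot⇒Dependency {k} {n} u {r} pivot≉0 (dependency c′ j c′≉0 rel) = dependency c (Fin.punchIn r j) c≉0 relation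
    where
    p = u r zero
    p⁻¹ = p ⁻¹⟨ pivot≉0 ⟩
    b : Fin k → Carrier
    b j = u (Fin.punchIn r j) zero * p⁻¹
    -- the pivot row's coefficient, chosen so that column 0 cancels
    x = - ∑[ j < k ] (c′ j * b j)
    c = insertAt c′ r x
    c≉0 : ¬ c (Fin.punchIn r j) ≈ 0#
    c≉0 eq = c′≉0 (trans (reflexive (≡.sym (insertAt-punchIn c′ r x j))) eq)
    S : Fin (suc n) → Carrier
    S i = ∑[ j < k ] (c′ j * u (Fin.punchIn r j) i)
    split : ∀ i → ∑[ s < suc k ] (c s * u s i) ≈ x * u r i + S i
    split i = trans (sum-remove (λ s → c s * u s i))
                    (+-cong (*-congʳ (reflexive (insertAt-lookup c′ r x)))
                            (sum-cong-≋ (λ j → *-congʳ (reflexive (insertAt-punchIn c′ r x j)))))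
    ∑c′b≈S₀p⁻¹ : ∑[ j < k ] (c′ j * b j) ≈ S zero * p⁻¹
    ∑c′b≈S₀p⁻¹ = trans (sum-cong-≋ (λ j → sym (*-assoc (c′ j) _ p⁻¹)))
                        (sym (*-distribʳ-sum p⁻¹ (λ j → c′ j * u (Fin.punchIn r j) zero)))
    relation : ∀ i → ∑[ s < suc k ] (c s * u s i) ≈ 0#
    relation zero = begin
      ∑[ s < suc k ] (c s * u s zero)   ≈⟨ split zero ⟩
      x * p + S zero                    ≈⟨ +-congʳ (*-congʳ (-‿cong ∑c′b≈S₀p⁻¹)) ⟩
      - (S zero * p⁻¹) * p + S zero     ≈⟨ +-congʳ (-‿distribˡ-* (S zero * p⁻¹) p) ⟨
      - (S zero * p⁻¹ * p) + S zero     ≈⟨ +-congʳ (-‿cong (*-assoc (S zero) p⁻¹ p)) ⟩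
      - (S zero * (p⁻¹ * p)) + S zero   ≈⟨ +-congʳ (-‿cong (*-congˡ (*-inverseˡ pivot≉0))) ⟩
      - (S zero * 1#) + S zero          ≈⟨ +-congʳ (-‿cong (*-identityʳ (S zero))) ⟩
      - S zero + S zero                 ≈⟨ -‿inverseˡ (S zero) ⟩
      0#                                ∎
    relation (suc i) = begin
      ∑[ s < suc k ] (c s * u s (suc i))             ≈⟨ split (suc i) ⟩
      x * w + S (suc i)                              ≈⟨ +-comm _ _ ⟩
      S (suc i) + x * w                              ≈⟨ +-congˡ (-‿distribˡ-* _ w) ⟨
      S (suc i) - ∑[ j < k ] (c′ j * b j) * w        ≈⟨ +-congˡ (-‿cong (*-distribʳ-sum w (λ j → c′ j * b j))) ⟩
      S (suc i) - ∑[ j < k ] (c′ j * b j * w)        ≈⟨ +-congˡ (-‿cong (sum-cong-≋ (λ j → *-assoc (c′ j) (b j) w))) ⟩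
      S (suc i) - ∑[ j < k ] (c′ j * (b j * w))      ≈⟨ +-congˡ (sum-neg (λ j → c′ j * (b j * w))) ⟨
      S (suc i) + ∑[ j < k ] (- (c′ j * (b j * w)))  ≈⟨ ∑-distrib-+ (λ j → c′ j * u′ j) (λ j → - (c′ j * (b j * w))) ⟨
      ∑[ j < k ] (c′ j * u′ j - c′ j * (b j * w))    ≈⟨ sum-cong-≋ (λ j → x[y-z]≈xy-xz (c′ j) (u′ j) (b j * w)) ⟨
      ∑[ j < k ] (c′ j * eliminate u pivot≉0 j i)    ≈⟨ rel i ⟩
      0#                                             ∎
      where
      w = u r (suc i)
      u′ : Fin k → Carrier
      u′ j = u (Fin.punchIn r j) (suc i)

  too-many-vectors⇒Dependency : ∀ n (u : Fin (suc n) → Fin n → Carrier) → Dependency u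
  too-many-vectors⇒Dependency zero u = dependency (λ _ → 1#) zero (0≉1 ∘ sym) (λ ())
  too-many-vectors⇒Dependency (suc n) u with Fin.any? (λ j → ¬? (u j zero ≟ 0#))
  ... | yes (r , pivot≉0) = pivot⇒Dependency u pivot≉0 (too-many-vectors⇒Dependency n _)
  ... | no no-pivot = zero-column⇒Dependency u column≈0 (too-many-vectors⇒Dependency n _)
    where
    column≈0 : ∀ j → u j zero ≈ 0#
    column≈0 j = decidable-stable (u j zero ≟ 0#) (λ uⱼ≉0 → no-pivot (j , uⱼ≉0))

  δ : ∀ {n} → Fin n → Fin n → Carrier
  δ zero zero = 1#
  δ zero (suc _) = 0#
  δ (suc _) zero = 0#
  δ (suc s) (suc t) = δ s t

  ∑[δ*f] : ∀ {n} t (f : Fin n → Carrier) → ∑[ s < n ] (δ t s * f s) ≈ f t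
  ∑[δ*f] {suc n} zero f = trans (+-cong (*-identityˡ _) (sum-≈0 {n} λ s → zeroˡ (f (suc s)))) (+-identityʳ _)
  ∑[δ*f] (suc t) f = trans (+-cong (zeroˡ _) (∑[δ*f] t (f ∘ suc))) (+-identityˡ _)

  ∑[f*δ] : ∀ {n} (f : Fin n → Carrier) t → ∑[ s < n ] (f s * δ s t) ≈ f t
  ∑[f*δ] {suc n} f zero = trans (+-cong (*-identityʳ _) (sum-≈0 {n} λ s → zeroʳ (f (suc s)))) (+-identityʳ _)
  ∑[f*δ] f (suc t) = trans (+-cong (zeroʳ _) (∑[f*δ] (f ∘ suc) t)) (+-identityˡ _)

  ¬Dependency-δ : ∀ {n} → ¬ Dependency (δ {n})
  ¬Dependency-δ (dependency c j c≉0 rel) = c≉0 (trans (sym (∑[f*δ] c j)) (rel j))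

module Span {a ℓ} (F : CommutativeRing a ℓ) (isField : IsField F)
    (_≟_ : (x y : CommutativeRing.Carrier F) → Dec (CommutativeRing._≈_ F x y)) (q : ℕ) where
  open CommutativeRing F hiding (zero)
  open import Relation.Binary.Reasoning.Setoid setoid
  open import Algebra.Properties.Ring ring using (-‿distribˡ-*; -‿distribʳ-*)
  open import Algebra.Properties.Group +-group using (inverseˡ-unique)
  open import Algebra.Properties.Semiring.Sum semiring
  open import Data.Vec.Functional.Properties using (updateAt-updates; updateAt-minimal)
  open SumSupport +-commutativeMonoid using (sum-≈0; sum-pair)
  open Field F isField
  open Matrices F isField _≟_
  open PG8 F q

  lincomb≈∑ : ∀ {k} (cs : Fin k → Carrier) (vs : Fin k → V) t → lincomb cs vs t ≈ ∑[ j < k ] (cs j * vs j t)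
  lincomb≈∑ {zero} cs vs t = refl
  lincomb≈∑ {suc k} cs vs t = +-congˡ (lincomb≈∑ (cs ∘ suc) (vs ∘ suc) t)

  lincomb-cong : ∀ {k} {cs ds : Fin k → Carrier} {vs ws : Fin k → V} →
                 (∀ j → cs j ≈ ds j) → (∀ j → vs j ≈v ws j) → lincomb cs vs ≈v lincomb ds ws
  lincomb-cong {zero} _ _ t = refl
  lincomb-cong {suc k} cs≈ds vs≈ws t =
    +-cong (*-cong (cs≈ds zero) (vs≈ws zero t)) (lincomb-cong (cs≈ds ∘ suc) (vs≈ws ∘ suc) t)

  lincomb-zero : ∀ {k} {cs : Fin k → Carrier} (vs : Fin k → V) → (∀ j → cs j ≈ 0#) → lincomb cs vs ≈v 0v
  lincomb-zero {cs = cs} vs cs≈0 t = trans (lincomb≈∑ cs vs t) (sum-≈0 (λ j → trans (*-congʳ (cs≈0 j)) (zeroˡ _)))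

  ++-suc : ∀ {b} {A : Set b} {m n} (xs : Fin (suc m) → A) (ys : Fin n → A) i →
           (xs ++ ys) (suc i) ≡ ((xs ∘ suc) ++ ys) i
  ++-suc {m = m} xs ys i with Fin.splitAt m i
  ... | inj₁ _ = ≡.refl
  ... | inj₂ _ = ≡.refl

  lincomb-++ : ∀ {m n} (α : Fin m → Carrier) (β : Fin n → Carrier) (f : Fin m → V) (g : Fin n → V) →
               lincomb (α ++ β) (f ++ g) ≈v (lincomb α f +v lincomb β g)
  lincomb-++ {zero} α β f g t = sym (+-identityˡ _)
  lincomb-++ {suc m} α β f g t = begin
    α zero * f zero t + lincomb ((α ++ β) ∘ suc) ((f ++ g) ∘ suc) t     ≈⟨ +-congˡ (lincomb-cong α≈ f≈ t) ⟩
    α zero * f zero t + lincomb ((α ∘ suc) ++ β) ((f ∘ suc) ++ g) t     ≈⟨ +-congˡ (lincomb-++ (α ∘ suc) β (f ∘ suc) g t) ⟩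
    α zero * f zero t + (lincomb (α ∘ suc) (f ∘ suc) t + lincomb β g t) ≈⟨ +-assoc _ _ _ ⟨
    lincomb α f t + lincomb β g t                                        ∎
    where
    α≈ : ∀ j → (α ++ β) (suc j) ≈ ((α ∘ suc) ++ β) j
    α≈ j = reflexive (++-suc α β j)
    f≈ : ∀ j → (f ++ g) (suc j) ≈v ((f ∘ suc) ++ g) j
    f≈ j t = reflexive (≡.cong (λ h → h t) (++-suc f g j))

  ∈span-resp : ∀ {k} {vs : Fin k → V} {u w} → u ≈v w → InSpan vs w → InSpan vs u
  ∈span-resp u≈w (cs , w≈) = cs , λ t → trans (u≈w t) (w≈ t)

  ∈span-scale : ∀ {k} {vs : Fin k → V} d {u} → InSpan vs u → InSpan vs (d ·v u)
  ∈span-scale {k} {vs} d (cs , u≈) = (λ j → d * cs j) , λ t → begin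
    d * _                            ≈⟨ *-congˡ (trans (u≈ t) (lincomb≈∑ cs vs t)) ⟩
    d * ∑[ j < k ] (cs j * vs j t)   ≈⟨ *-∑-assoc d cs (λ j → vs j t) ⟩
    ∑[ j < k ] (d * cs j * vs j t)   ≈⟨ lincomb≈∑ (λ j → d * cs j) vs t ⟨
    lincomb (λ j → d * cs j) vs t    ∎

  ∈span-+ : ∀ {k} {vs : Fin k → V} {u w} → InSpan vs u → InSpan vs w → InSpan vs (u +v w)
  ∈span-+ {k} {vs} (cs , u≈) (ds , w≈) = (λ j → cs j + ds j) , λ t → begin
    _ + _                                                    ≈⟨ +-cong (trans (u≈ t) (lincomb≈∑ cs vs t)) (trans (w≈ t) (lincomb≈∑ ds vs t)) ⟩
    ∑[ j < k ] (cs j * vs j t) + ∑[ j < k ] (ds j * vs j t)  ≈⟨ ∑-distrib-+ (λ j → cs j * vs j t) (λ j → ds j * vs j t) ⟨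
    ∑[ j < k ] (cs j * vs j t + ds j * vs j t)              ≈⟨ sum-cong-≋ (λ j → distribʳ (vs j t) (cs j) (ds j)) ⟨
    ∑[ j < k ] ((cs j + ds j) * vs j t)                     ≈⟨ lincomb≈∑ (λ j → cs j + ds j) vs t ⟨
    lincomb (λ j → cs j + ds j) vs t                        ∎

  ∈span-member : ∀ {k} (vs : Fin k → V) j → InSpan vs (vs j)
  ∈span-member vs j = δ j , λ t → sym (trans (lincomb≈∑ (δ j) vs t) (∑[δ*f] j (λ s → vs s t)))

  ∑-change-basis : ∀ {k m} {ws : Fin m → V} {us : Fin k → V} (us∈ : ∀ j → InSpan ws (us j))
                   (cs : Fin k → Carrier) t →
                   ∑[ j < k ] (cs j * us j t) ≈ ∑[ i < m ] (∑[ j < k ] (cs j * proj₁ (us∈ j) i) * ws i t)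
  ∑-change-basis {k} {m} {ws} {us} us∈ cs t = begin
    ∑[ j < k ] (cs j * us j t)                       ≈⟨ sum-cong-≋ {k} {λ j → cs j * us j t} us≈ ⟩
    ∑[ j < k ] (cs j * ∑[ i < m ] (M j i * ws i t))  ≈⟨ ∑-assoc cs M (λ i → ws i t) ⟩
    ∑[ i < m ] (∑[ j < k ] (cs j * M j i) * ws i t)  ∎
    where
    M : Fin k → Fin m → Carrier
    M j = proj₁ (us∈ j)
    us≈ : ∀ j → cs j * us j t ≈ cs j * ∑[ i < m ] (M j i * ws i t)
    us≈ j = *-congˡ (trans (proj₂ (us∈ j) t) (lincomb≈∑ (M j) ws t))

  ∈span-trans : ∀ {k m} {ws : Fin m → V} {us : Fin k → V} →
                (∀ j → InSpan ws (us j)) → ∀ {v} → InSpan us v → InSpan ws v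
  ∈span-trans {ws = ws} {us} us∈ (cs , v≈) = _ , λ t →
    trans (v≈ t) (trans (lincomb≈∑ cs us t) (trans (∑-change-basis us∈ cs t) (sym (lincomb≈∑ _ ws t))))

  spanned-by-fewer⇒Dependency : ∀ {m} {ws : Fin m → V} {us : Fin (suc m) → V} →
                                (∀ j → InSpan ws (us j)) → Dependency us
  spanned-by-fewer⇒Dependency {m} us∈ with too-many-vectors⇒Dependency m (λ j → proj₁ (us∈ j))
  ... | dependency c j c≉0 rel = dependency c j c≉0 λ t →
    trans (∑-change-basis us∈ c t) (sum-≈0 (λ i → trans (*-congʳ (rel i)) (zeroˡ _)))

  relation⇒∈span-others : ∀ {k} (cs : Fin (suc k) → Carrier) (vs : Fin (suc k) → V) j →
                          (∀ t → ∑[ s < suc k ] (cs s * vs s t) ≈ 0#) → ¬ cs j ≈ 0# → InSpan (removeAt vs j) (vs j)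
  relation⇒∈span-others {k} cs vs j rel cⱼ≉0 = (λ s → - cⱼ⁻¹ * cs (Fin.punchIn j s)) , λ t → begin
    vs j t                 ≈⟨ a*x≈y⇒x≈a⁻¹*y cⱼ≉0 (inverseˡ-unique _ (R t) (trans (sym (sum-remove (λ s → cs s * vs s t))) (rel t))) ⟩
    cⱼ⁻¹ * - R t           ≈⟨ -‿distribʳ-* cⱼ⁻¹ (R t) ⟨
    - (cⱼ⁻¹ * R t)         ≈⟨ -‿distribˡ-* cⱼ⁻¹ (R t) ⟩
    - cⱼ⁻¹ * R t           ≈⟨ *-∑-assoc (- cⱼ⁻¹) (cs ∘ Fin.punchIn j) (λ s → vs (Fin.punchIn j s) t) ⟩
    ∑[ s < k ] (- cⱼ⁻¹ * cs (Fin.punchIn j s) * vs (Fin.punchIn j s) t) ≈⟨ lincomb≈∑ _ (removeAt vs j) t ⟨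
    lincomb (λ s → - cⱼ⁻¹ * cs (Fin.punchIn j s)) (removeAt vs j) t ∎
    where
    cⱼ⁻¹ = cs j ⁻¹⟨ cⱼ≉0 ⟩
    R : Fin 9 → Carrier
    R t = ∑[ s < k ] (cs (Fin.punchIn j s) * vs (Fin.punchIn j s) t)

  Dependency-∷⇒∈span : ∀ {k} {v} {us : Fin k → V} → LinIndep us → Dependency (v ∷ us) → InSpan us v
  Dependency-∷⇒∈span {k} {v} {us} us-indep (dependency c j c≉0 rel) with c zero ≟ 0#
  ... | no c₀≉0 = relation⇒∈span-others c (v ∷ us) zero rel c₀≉0
  ... | yes c₀≈0 = contradiction (c≈0 j) c≉0
    where
    tail≈0 : lincomb (c ∘ suc) us ≈v 0v
    tail≈0 t = begin
      lincomb (c ∘ suc) us t                          ≈⟨ lincomb≈∑ (c ∘ suc) us t ⟩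
      ∑[ s < k ] (c (suc s) * us s t)                 ≈⟨ +-identityˡ _ ⟨
      0# + ∑[ s < k ] (c (suc s) * us s t)            ≈⟨ +-congʳ (trans (*-congʳ c₀≈0) (zeroˡ (v t))) ⟨
      c zero * v t + ∑[ s < k ] (c (suc s) * us s t)  ≈⟨ rel t ⟩
      0#                                              ∎
    c≈0 : ∀ s → c s ≈ 0#
    c≈0 zero = c₀≈0
    c≈0 (suc s) = us-indep (c ∘ suc) tail≈0 s

  spanning⇒LinIndep : (ws : Fin 9 → V) → (∀ v → InSpan ws v) → LinIndep ws
  spanning⇒LinIndep ws ws-span cs cs·ws≈0 j = decidable-stable (cs j ≟ 0#) λ cⱼ≉0 →
    ¬Dependency-δ (spanned-by-fewer⇒Dependency {ws = others} {us = δ} λ s →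
      ∈span-trans {ws = others} {us = ws} (ws∈others cⱼ≉0) (ws-span (δ s)))
    where
    others = removeAt ws j
    ws∈others : ¬ cs j ≈ 0# → ∀ s → InSpan others (ws s)
    ws∈others cⱼ≉0 s with s Fin.≟ j
    ... | yes ≡.refl = relation⇒∈span-others cs ws j (λ t → trans (sym (lincomb≈∑ cs ws t)) (cs·ws≈0 t)) cⱼ≉0
    ... | no s≢j = ≡.subst (InSpan others ∘ ws) (Fin.punchIn-punchOut j≢s) (∈span-member others (Fin.punchOut j≢s))
      where j≢s = s≢j ∘ ≡.sym

  NonZero-scale≈0 : ∀ {x : V} {d} → NonZero x → (∀ t → d * x t ≈ 0#) → d ≈ 0#
  NonZero-scale≈0 (t , xₜ≉0) d*x≈0 = a*x≈0⇒x≈0 xₜ≉0 (trans (*-comm _ _) (d*x≈0 t))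

  LinIndep-point : ∀ {x} → NonZero x → LinIndep (pointOf x)
  LinIndep-point x≢0 cs cs·x≈0 zero = NonZero-scale≈0 x≢0 (λ t → trans (sym (+-identityʳ _)) (cs·x≈0 t))

  LinIndep-pair : ∀ {k} {X : Fin k → V} → LinIndep X → ∀ {i j} → i ≢ j → LinIndep (X i ∷ X j ∷ [])
  LinIndep-pair {k} {X} X-indep {i} {j} i≢j cs cs·X≈0 = cs≈0
    where
    α : Fin k → Carrier
    α = updateAt (updateAt (λ _ → 0#) i (λ _ → cs zero)) j (λ _ → cs (suc zero))
    αᵢ≡ : α i ≡ cs zero
    αᵢ≡ = ≡.trans (updateAt-minimal i j _ i≢j) (updateAt-updates i _)
    αⱼ≡ : α j ≡ cs (suc zero)
    αⱼ≡ = updateAt-updates j _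
    α≡0 : ∀ s → s ≢ i → s ≢ j → α s ≡ 0#
    α≡0 s s≢i s≢j = ≡.trans (updateAt-minimal s j _ s≢j) (updateAt-minimal s i _ s≢i)
    ≈0⇒*X≈0 : ∀ {t} s → s ≢ i → s ≢ j → α s * X s t ≈ 0#
    ≈0⇒*X≈0 s s≢i s≢j = trans (*-congʳ (reflexive (α≡0 s s≢i s≢j))) (zeroˡ _)
    α·X≈0 : lincomb α X ≈v 0v
    α·X≈0 t = begin
      lincomb α X t                            ≈⟨ lincomb≈∑ α X t ⟩
      ∑[ s < k ] (α s * X s t)                 ≈⟨ sum-pair (λ s → α s * X s t) i≢j ≈0⇒*X≈0 ⟩
      α i * X i t + α j * X j t                ≈⟨ +-cong (*-congʳ (reflexive αᵢ≡)) (*-congʳ (reflexive αⱼ≡)) ⟩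
      cs zero * X i t + cs (suc zero) * X j t  ≈⟨ +-congˡ (+-identityʳ _) ⟨
      lincomb cs (X i ∷ X j ∷ []) t            ≈⟨ cs·X≈0 t ⟩
      0#                                       ∎
    cs≈0 : ∀ s → cs s ≈ 0#
    cs≈0 zero = trans (reflexive (≡.sym αᵢ≡)) (X-indep α α·X≈0 i)
    cs≈0 (suc zero) = trans (reflexive (≡.sym αⱼ≡)) (X-indep α α·X≈0 j)

  IntersectionIs-span : ∀ {k m n} {S : Subsp k} {T : Subsp m} {b : Fin n → V} (b-indep : LinIndep b) →
                        (∀ {v} → v ∈ S → v ∈ T → InSpan b v) → (∀ s → b s ∈ S) → (∀ s → b s ∈ T) →
                        IntersectionIs S T (subsp b b-indep)
  IntersectionIs-span _ S∩T⊆b b∈S b∈T v =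
    (λ (v∈S , v∈T) → S∩T⊆b v∈S v∈T) , λ v∈b → ∈span-trans b∈S v∈b , ∈span-trans b∈T v∈b

  infix 4 _∝_
  _∝_ : V → V → Set (a ⊔ ℓ)
  x ∝ y = ∃[ d ] (x ≈v (d ·v y))

  ∝? : ∀ x {y} → NonZero y → Dec (x ∝ y)
  ∝? x {y} (t , yₜ≉0) = map′ (d ,_) (λ (d′ , x≈d′y) s → trans (x≈d′y s) (*-congʳ (d′≈d d′ x≈d′y)))
                               (Fin.all? (λ s → x s ≟ (d * y s)))
    where
    d = y t ⁻¹⟨ yₜ≉0 ⟩ * x t
    d′≈d : ∀ d′ → x ≈v (d′ ·v y) → d′ ≈ d
    d′≈d d′ x≈d′y = a*x≈y⇒x≈a⁻¹*y yₜ≉0 (trans (*-comm (y t) d′) (sym (x≈d′y t)))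

  ∝-sym : ∀ {x y} → NonZero x → x ∝ y → y ∝ x
  ∝-sym (t , xₜ≉0) (d , x≈dy) with d ≟ 0#
  ... | yes d≈0 = contradiction (trans (x≈dy t) (trans (*-congʳ d≈0) (zeroˡ _))) xₜ≉0
  ... | no d≉0 = d ⁻¹⟨ d≉0 ⟩ , λ s → a*x≈y⇒x≈a⁻¹*y d≉0 (sym (x≈dy s))

  ∝-∈span : ∀ {k} {vs : Fin k → V} {x y} → x ∝ y → InSpan vs y → InSpan vs x
  ∝-∈span (d , x≈dy) y∈ = ∈span-resp x≈dy (∈span-scale d y∈)

  ¬∝⇒coeff≈0 : ∀ {x y c d} → (c ·v x) ≈v (d ·v y) → ¬ x ∝ y → c ≈ 0#
  ¬∝⇒coeff≈0 {y = y} {c} {d} cx≈dy ¬x∝y = decidable-stable (c ≟ 0#) λ c≉0 →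
    ¬x∝y (c ⁻¹⟨ c≉0 ⟩ * d , λ s → trans (a*x≈y⇒x≈a⁻¹*y c≉0 (cx≈dy s)) (sym (*-assoc _ d (y s))))

ConjugatesSpanned : ∀ {a ℓ} (F : CommutativeRing a ℓ) (q : ℕ) → Set (a ⊔ ℓ)
ConjugatesSpanned F q = ∀ n {k} (S : Subsp k) {v} → Conj n S v → InSpan (λ j → frobⁿ n (Subsp.basis S j)) v
  where open PG8 F q

module Conjugates {a ℓ} (F : CommutativeRing a ℓ) {p k q : ℕ} (p-prime : Prime p) (q≡pᵏ : q ≡ p ^ k) where
  open CommutativeRing F hiding (zero)
  open import Relation.Binary.Reasoning.Setoid setoid
  open import Algebra.Properties.Semiring.Mult semiring using () renaming (_×_ to _×ₘ_)
  open import Algebra.Properties.Semiring.Exp semiring using (^-congˡ) renaming (_^_ to _^ʳ_)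
  open import Algebra.Properties.CommutativeSemiring.Exp commutativeSemiring using (^-distrib-*)
  open import Algebra.Properties.Ring ring using (x+x≈x⇒x≈0)
  open Frobenius commutativeSemiring p-prime using (^pᵐ-homo-+)
  open PG8 F q

  pow≡^ʳ : ∀ x m → pow x m ≡ x ^ʳ m
  pow≡^ʳ x zero = ≡.refl
  pow≡^ʳ x (suc m) = ≡.cong (x *_) (pow≡^ʳ x m)

  pow-cong : ∀ m {x y} → x ≈ y → pow x m ≈ pow y m
  pow-cong m {x} {y} x≈y = begin
    pow x m   ≡⟨ pow≡^ʳ x m ⟩
    x ^ʳ m    ≈⟨ ^-congˡ m x≈y ⟩
    y ^ʳ m    ≡⟨ pow≡^ʳ y m ⟨
    pow y m   ∎

  pow-homo-* : ∀ m x y → pow (x * y) m ≈ pow x m * pow y m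
  pow-homo-* m x y = begin
    pow (x * y) m      ≡⟨ pow≡^ʳ (x * y) m ⟩
    (x * y) ^ʳ m       ≈⟨ ^-distrib-* x y m ⟩
    x ^ʳ m * y ^ʳ m    ≡⟨ ≡.cong₂ _*_ (pow≡^ʳ x m) (pow≡^ʳ y m) ⟨
    pow x m * pow y m  ∎

  module _ (p×1≈0 : p ×ₘ 1# ≈ 0#) where

    pow-q^n-homo-+ : ∀ n x y → pow (x + y) (q ^ n) ≈ pow x (q ^ n) + pow y (q ^ n)
    pow-q^n-homo-+ n x y = begin
      pow (x + y) (q ^ n)                               ≡⟨ pow-q^n (x + y) ⟩
      (x + y) ^ʳ (p ^ (k ℕ.* n))                        ≈⟨ ^pᵐ-homo-+ p×1≈0 (k ℕ.* n) x y ⟩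
      x ^ʳ (p ^ (k ℕ.* n)) + y ^ʳ (p ^ (k ℕ.* n))       ≡⟨ ≡.cong₂ _+_ (pow-q^n x) (pow-q^n y) ⟨
      pow x (q ^ n) + pow y (q ^ n)                     ∎
      where
      pow-q^n : ∀ z → pow z (q ^ n) ≡ z ^ʳ (p ^ (k ℕ.* n))
      pow-q^n z = ≡.trans (pow≡^ʳ z (q ^ n)) (≡.cong (z ^ʳ_) (≡.trans (≡.cong (_^ n) q≡pᵏ) (ℕ.^-*-assoc p k n)))

    pow-q^n-0 : ∀ n → pow 0# (q ^ n) ≈ 0#
    pow-q^n-0 n = x+x≈x⇒x≈0 (pow 0# (q ^ n)) (begin
      pow 0# (q ^ n) + pow 0# (q ^ n)  ≈⟨ pow-q^n-homo-+ n 0# 0# ⟨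
      pow (0# + 0#) (q ^ n)            ≈⟨ pow-cong (q ^ n) (+-identityˡ 0#) ⟩
      pow 0# (q ^ n)                   ∎)

    frobⁿ-lincomb : ∀ n {m} (cs : Fin m → Carrier) (vs : Fin m → V) →
                    frobⁿ n (lincomb cs vs) ≈v lincomb (λ j → pow (cs j) (q ^ n)) (λ j → frobⁿ n (vs j))
    frobⁿ-lincomb n {zero} cs vs t = pow-q^n-0 n
    frobⁿ-lincomb n {suc m} cs vs t = trans (pow-q^n-homo-+ n _ _)
      (+-cong (pow-homo-* (q ^ n) (cs zero) (vs zero t)) (frobⁿ-lincomb n (cs ∘ suc) (vs ∘ suc) t))

    Conj⇒∈span : ConjugatesSpanned F q
    Conj⇒∈span n S (x , (cs , x≈) , v≈) = (λ j → pow (cs j) (q ^ n)) , λ t →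
      trans (v≈ t) (trans (pow-cong (q ^ n) (x≈ t)) (frobⁿ-lincomb n cs (Subsp.basis S) t))

data Support {p} (Q : Fin 3 → Set p) : Set p where
  all : (∀ i → Q i) → Support Q
  none : (∀ i → ¬ Q i) → Support Q
  one : ∀ {i} → Q i → (∀ s → s ≢ i → ¬ Q s) → Support Q
  two : ∀ {i j} → i ≢ j → Q i → Q j → (∀ s → s ≢ i → s ≢ j → ¬ Q s) → Support Q

support : ∀ {p} {Q : Fin 3 → Set p} → (∀ i → Dec (Q i)) → Support Q
support Q? with Q? 0F | Q? 1F | Q? 2F
... | yes q₀ | yes q₁ | yes q₂ = all λ { 0F → q₀ ; 1F → q₁ ; 2F → q₂ }
... | no ¬q₀ | no ¬q₁ | no ¬q₂ = none λ { 0F → ¬q₀ ; 1F → ¬q₁ ; 2F → ¬q₂ }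
... | yes q₀ | no ¬q₁ | no ¬q₂ = one q₀ λ where
  0F s≢0 → contradiction ≡.refl s≢0
  1F _ → ¬q₁
  2F _ → ¬q₂
... | no ¬q₀ | yes q₁ | no ¬q₂ = one q₁ λ where
  0F _ → ¬q₀
  1F s≢1 → contradiction ≡.refl s≢1
  2F _ → ¬q₂
... | no ¬q₀ | no ¬q₁ | yes q₂ = one q₂ λ where
  0F _ → ¬q₀
  1F _ → ¬q₁
  2F s≢2 → contradiction ≡.refl s≢2
... | yes q₀ | yes q₁ | no ¬q₂ = two (λ ()) q₀ q₁ λ where
  0F s≢0 _ → contradiction ≡.refl s≢0
  1F _ s≢1 → contradiction ≡.refl s≢1
  2F _ _ → ¬q₂
... | yes q₀ | no ¬q₁ | yes q₂ = two (λ ()) q₀ q₂ λ where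
  0F s≢0 _ → contradiction ≡.refl s≢0
  1F _ _ → ¬q₁
  2F _ s≢2 → contradiction ≡.refl s≢2
... | no ¬q₀ | yes q₁ | yes q₂ = two (λ ()) q₁ q₂ λ where
  0F _ _ → ¬q₀
  1F s≢1 _ → contradiction ≡.refl s≢1
  2F _ s≢2 → contradiction ≡.refl s≢2

module TPlanes {a ℓ} (F : CommutativeRing a ℓ) (isField : IsField F)
    (_≟_ : (x y : CommutativeRing.Carrier F) → Dec (CommutativeRing._≈_ F x y)) (q : ℕ)
    (Conj⇒∈span : ConjugatesSpanned F q) (Γ : PG8.Plane F q) (Γ-spanning : PG8.ConjugatesSpan F q Γ) where
  open CommutativeRing F hiding (zero)
  open PG8 F q
  open import Relation.Binary.Reasoning.Setoid setoid
  open import Data.Vec.Functional.Properties using (lookup-++ˡ; lookup-++ʳ)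
  open import Algebra.Properties.Ring ring using (-‿distribˡ-*)
  open import Algebra.Properties.Group +-group using (x∙y⁻¹≈ε⇒x≈y)
  open import Algebra.Properties.Semiring.Sum semiring using (sum-syntax; sum-cong-≋; ∑-distrib-+)
  open SumSupport +-commutativeMonoid using (sum-single; sum-pair)
  open Matrices F isField _≟_ using (sum-neg)
  open Span F isField _≟_ q

  G : Fin 3 → Fin 3 → V
  G i j = frobⁿ (toℕ i) (Subsp.basis Γ j)

  Tr⇒∈span : ∀ i {v} → Tr Γ i v → InSpan (G i) v
  Tr⇒∈span 0F = Conj⇒∈span 0 Γ
  Tr⇒∈span 1F = Conj⇒∈span 1 Γ
  Tr⇒∈span 2F = Conj⇒∈span 2 Γ

  W : Fin 9 → V
  W = G 0F ++ G 1F ++ G 2F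

  W-spanning : ∀ v → InSpan W v
  W-spanning v with Γ-spanning v
  ... | (x , y , z , x∈ , y∈ , z∈ , v≈) = α ++ β ++ γ , λ t → begin
    v t                                                       ≈⟨ v≈ t ⟩
    (x t + y t) + z t                                         ≈⟨ +-assoc _ _ _ ⟩
    x t + (y t + z t)                                         ≈⟨ +-cong (x≈ t) (+-cong (y≈ t) (z≈ t)) ⟩
    lincomb α (G 0F) t + (lincomb β (G 1F) t + lincomb γ (G 2F) t) ≈⟨ +-congˡ (lincomb-++ β γ (G 1F) (G 2F) t) ⟨
    lincomb α (G 0F) t + lincomb (β ++ γ) (G 1F ++ G 2F) t   ≈⟨ lincomb-++ α (β ++ γ) (G 0F) (G 1F ++ G 2F) t ⟨
    lincomb (α ++ β ++ γ) W t                                 ∎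
    where
    α = proj₁ (Conj⇒∈span 0 Γ x∈) ; x≈ = proj₂ (Conj⇒∈span 0 Γ x∈)
    β = proj₁ (Conj⇒∈span 1 Γ y∈) ; y≈ = proj₂ (Conj⇒∈span 1 Γ y∈)
    γ = proj₁ (Conj⇒∈span 2 Γ z∈) ; z≈ = proj₂ (Conj⇒∈span 2 Γ z∈)

  direct-sum : (Y : Fin 3 → V) → (∀ i → InSpan (G i) (Y i)) → (∀ t → ∑[ i < 3 ] Y i t ≈ 0#) → ∀ i → Y i ≈v 0v
  direct-sum Y Y∈ ∑Y≈0 i t = trans (proj₂ (Y∈ i) t) (lincomb-zero (G i) (α≈0 i) t)
    where
    α : Fin 3 → Fin 3 → Carrier
    α i = proj₁ (Y∈ i)
    Y≈ : ∀ i → Y i ≈v lincomb (α i) (G i)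
    Y≈ i = proj₂ (Y∈ i)
    all≈0 : ∀ s → (α 0F ++ α 1F ++ α 2F) s ≈ 0#
    all≈0 = spanning⇒LinIndep W W-spanning (α 0F ++ α 1F ++ α 2F) λ t → begin
      lincomb (α 0F ++ α 1F ++ α 2F) W t
        ≈⟨ lincomb-++ (α 0F) (α 1F ++ α 2F) (G 0F) (G 1F ++ G 2F) t ⟩
      lincomb (α 0F) (G 0F) t + lincomb (α 1F ++ α 2F) (G 1F ++ G 2F) t
        ≈⟨ +-congˡ (lincomb-++ (α 1F) (α 2F) (G 1F) (G 2F) t) ⟩
      lincomb (α 0F) (G 0F) t + (lincomb (α 1F) (G 1F) t + lincomb (α 2F) (G 2F) t)
        ≈⟨ +-cong (Y≈ 0F t) (+-cong (Y≈ 1F t) (Y≈ 2F t)) ⟨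
      Y 0F t + (Y 1F t + Y 2F t)
        ≈⟨ +-congˡ (+-congˡ (+-identityʳ _)) ⟨
      ∑[ i < 3 ] Y i t
        ≈⟨ ∑Y≈0 t ⟩
      0#
        ∎
    α≈0 : ∀ i j → α i j ≈ 0#
    α≈0 0F j = trans (reflexive (≡.sym (lookup-++ˡ (α 0F) (α 1F ++ α 2F) j))) (all≈0 (j ↑ˡ 6))
    α≈0 1F j = trans (reflexive (≡.sym (≡.trans (lookup-++ʳ (α 0F) (α 1F ++ α 2F) (j ↑ˡ 3))
                                                 (lookup-++ˡ (α 1F) (α 2F) j))))
                     (all≈0 (3 ↑ʳ (j ↑ˡ 3)))
    α≈0 2F j = trans (reflexive (≡.sym (≡.trans (lookup-++ʳ (α 0F) (α 1F ++ α 2F) (3 ↑ʳ j))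
                                                 (lookup-++ʳ (α 1F) (α 2F) j))))
                     (all≈0 (3 ↑ʳ (3 ↑ʳ j)))

  record Frame (P : Plane) : Set (a ⊔ ℓ) where
    field
      point : Fin 3 → V
      point≢0 : ∀ i → NonZero (point i)
      point∈P : ∀ i → point i ∈ P
      point∈Tr : ∀ i → Tr Γ i (point i)

    independent : LinIndep point
    independent α α·X≈0 i = NonZero-scale≈0 (point≢0 i)
      (direct-sum (λ i → α i ·v point i) (λ i → ∈span-scale {vs = G i} (α i) (Tr⇒∈span i (point∈Tr i))) α·X≈0 i)

    spans : ∀ {v} → v ∈ P → InSpan point v
    spans {v} v∈P = Dependency-∷⇒∈span independent (spanned-by-fewer⇒Dependency {ws = Subsp.basis P} v∷point∈P)
      where
      v∷point∈P : ∀ j → (v ∷ point) j ∈ P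
      v∷point∈P zero = v∈P
      v∷point∈P (suc i) = point∈P i

  frame : ∀ {P} → TPlane Γ P → Frame P
  frame tP = record
    { point = λ i → proj₁ (tP i)
    ; point≢0 = λ i → proj₁ (proj₂ (tP i))
    ; point∈P = λ i → proj₁ (proj₂ (proj₂ (tP i)))
    ; point∈Tr = λ i → proj₂ (proj₂ (proj₂ (tP i)))
    }

  TMeet : Plane → Plane → Set (a ⊔ ℓ)
  TMeet P P′ = SameSubsp P P′
             ⊎ Disjoint P P′
             ⊎ (∃[ p ] ∃[ pind ] (TPoint Γ p × IntersectionIs P P′ (subsp (pointOf p) pind)))
             ⊎ (∃[ L ] (TLine Γ L × IntersectionIs P P′ L))

  module Intersection {P P′ : Plane} (fr : Frame P) (fr′ : Frame P′) where
    open Frame fr renaming (point to X)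
    open Frame fr′ using ()
      renaming (point to X′; point≢0 to X′≢0; point∈P to X′∈P′; point∈Tr to X′∈Tr; spans to spans′)

    ∝⇒∈P′ : ∀ {i} → X i ∝ X′ i → X i ∈ P′
    ∝⇒∈P′ {i} X∝X′ = ∝-∈span {vs = Subsp.basis P′} X∝X′ (X′∈P′ i)

    common-coeffs≈0 : ∀ {v} (α β : Fin 3 → Carrier) → v ≈v lincomb α X → v ≈v lincomb β X′ →
                      ∀ i → ¬ X i ∝ X′ i → α i ≈ 0#
    common-coeffs≈0 {v} α β v≈αX v≈βX′ i = ¬∝⇒coeff≈0 {X i} {X′ i} {α i} {β i} λ t →
      x∙y⁻¹≈ε⇒x≈y _ _ (trans (+-congˡ (-‿distribˡ-* (β i) (X′ i t))) (Y≈0 i t))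
      where
      Y : Fin 3 → V
      Y i = (α i ·v X i) +v ((- β i) ·v X′ i)
      ∑Y≈0 : ∀ t → ∑[ i < 3 ] Y i t ≈ 0#
      ∑Y≈0 t = begin
        ∑[ i < 3 ] Y i t                                        ≈⟨ ∑-distrib-+ (λ i → α i * X i t) (λ i → - β i * X′ i t) ⟩
        ∑[ i < 3 ] (α i * X i t) + ∑[ i < 3 ] (- β i * X′ i t)  ≈⟨ +-congˡ ∑[-βX′]≈-∑[βX′] ⟩
        ∑[ i < 3 ] (α i * X i t) - ∑[ i < 3 ] (β i * X′ i t)    ≈⟨ +-cong (v≈αX t) (-‿cong (v≈βX′ t)) ⟨
        v t - v t                                               ≈⟨ -‿inverseʳ (v t) ⟩
        0#                                                      ∎
        where
        ∑[-βX′]≈-∑[βX′] : ∑[ i < 3 ] (- β i * X′ i t) ≈ - ∑[ i < 3 ] (β i * X′ i t)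
        ∑[-βX′]≈-∑[βX′] = trans (sum-cong-≋ {3} {λ i → - β i * X′ i t} (λ i → sym (-‿distribˡ-* (β i) (X′ i t))))
                                (sum-neg (λ i → β i * X′ i t))
      Y≈0 : ∀ i → Y i ≈v 0v
      Y≈0 = direct-sum Y (λ i → ∈span-+ {vs = G i} (∈span-scale {vs = G i} (α i) (Tr⇒∈span i (point∈Tr i)))
                                                  (∈span-scale {vs = G i} (- β i) (Tr⇒∈span i (X′∈Tr i)))) ∑Y≈0

    -- Kept opaque: a `with` on the unfolded `spans` makes Agda normalise the Gaussian elimination behind it.
    opaque
      ∩⇒lincomb : ∀ {v} → v ∈ P → v ∈ P′ →
                  ∃[ α ] (v ≈v lincomb α X × (∀ i → ¬ X i ∝ X′ i → α i ≈ 0#))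
      ∩⇒lincomb v∈P v∈P′ = proj₁ (spans v∈P) , proj₂ (spans v∈P) ,
        common-coeffs≈0 (proj₁ (spans v∈P)) (proj₁ (spans′ v∈P′)) (proj₂ (spans v∈P)) (proj₂ (spans′ v∈P′))

    ≈0⇒*X≈0 : ∀ {a t} s → a ≈ 0# → a * X s t ≈ 0#
    ≈0⇒*X≈0 s a≈0 = trans (*-congʳ a≈0) (zeroˡ _)

    same : (∀ i → X i ∝ X′ i) → SameSubsp P P′
    same X∝X′ v = (λ v∈P → ∈span-trans {ws = Subsp.basis P′} {us = X} (λ i → ∝⇒∈P′ (X∝X′ i)) (spans v∈P))
                , (λ v∈P′ → ∈span-trans {ws = Subsp.basis P} {us = X′} X′∈P (spans′ v∈P′))
      where
      X′∈P : ∀ i → X′ i ∈ P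
      X′∈P i = ∝-∈span {vs = Subsp.basis P} (∝-sym (point≢0 i) (X∝X′ i)) (point∈P i)

    disjoint : (∀ i → ¬ X i ∝ X′ i) → Disjoint P P′
    disjoint ¬X∝X′ v v∈P v∈P′ with ∩⇒lincomb v∈P v∈P′
    ... | α , v≈αX , α≈0 = λ t → trans (v≈αX t) (lincomb-zero X (λ i → α≈0 i (¬X∝X′ i)) t)

    meet-in-point : ∀ {i} → X i ∝ X′ i → (∀ s → s ≢ i → ¬ X s ∝ X′ s) →
                    IntersectionIs P P′ (subsp (pointOf (X i)) (LinIndep-point (point≢0 i)))
    meet-in-point {i} X∝X′ others =
      IntersectionIs-span {S = P} {T = P′} (LinIndep-point (point≢0 i)) ∩⊆ (λ _ → point∈P i) (λ _ → ∝⇒∈P′ X∝X′)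
      where
      ∩⊆ : ∀ {v} → v ∈ P → v ∈ P′ → InSpan (pointOf (X i)) v
      ∩⊆ v∈P v∈P′ with ∩⇒lincomb v∈P v∈P′
      ... | α , v≈αX , α≈0 = (λ _ → α i) , λ t → begin
        _                         ≈⟨ trans (v≈αX t) (lincomb≈∑ α X t) ⟩
        ∑[ s < 3 ] (α s * X s t)  ≈⟨ sum-single (λ s → α s * X s t) i (λ s s≢i → ≈0⇒*X≈0 s (α≈0 s (others s s≢i))) ⟩
        α i * X i t               ≈⟨ +-identityʳ _ ⟨
        α i * X i t + 0#          ∎

    meet-in-line : ∀ {i j} (i≢j : i ≢ j) → X i ∝ X′ i → X j ∝ X′ j →
                   (∀ s → s ≢ i → s ≢ j → ¬ X s ∝ X′ s) →
                   IntersectionIs P P′ (subsp (X i ∷ X j ∷ []) (LinIndep-pair independent i≢j))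
    meet-in-line {i} {j} i≢j Xᵢ∝X′ᵢ Xⱼ∝X′ⱼ others =
      IntersectionIs-span {S = P} {T = P′} (LinIndep-pair independent i≢j) ∩⊆ ∈P ∈P′
      where
      ∩⊆ : ∀ {v} → v ∈ P → v ∈ P′ → InSpan (X i ∷ X j ∷ []) v
      ∩⊆ v∈P v∈P′ with ∩⇒lincomb v∈P v∈P′
      ... | α , v≈αX , α≈0 = α i ∷ α j ∷ [] , λ t → begin
        _                                 ≈⟨ trans (v≈αX t) (lincomb≈∑ α X t) ⟩
        ∑[ s < 3 ] (α s * X s t)          ≈⟨ sum-pair (λ s → α s * X s t) i≢j (λ s s≢i s≢j → ≈0⇒*X≈0 s (α≈0 s (others s s≢i s≢j))) ⟩
        α i * X i t + α j * X j t         ≈⟨ +-congˡ (+-identityʳ _) ⟨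
        α i * X i t + (α j * X j t + 0#)  ∎
      ∈P : ∀ s → (X i ∷ X j ∷ []) s ∈ P
      ∈P 0F = point∈P i
      ∈P 1F = point∈P j
      ∈P′ : ∀ s → (X i ∷ X j ∷ []) s ∈ P′
      ∈P′ 0F = ∝⇒∈P′ Xᵢ∝X′ᵢ
      ∈P′ 1F = ∝⇒∈P′ Xⱼ∝X′ⱼ

    classify : Support (λ i → X i ∝ X′ i) → TMeet P P′
    classify (all X∝X′) = inj₁ (same X∝X′)
    classify (none ¬X∝X′) = inj₂ (inj₁ (disjoint ¬X∝X′))
    classify (one {i} X∝X′ others) =
      inj₂ (inj₂ (inj₁ (X i , LinIndep-point (point≢0 i) , (point≢0 i , i , point∈Tr i) , meet-in-point X∝X′ others)))
    classify (two {i} {j} i≢j Xᵢ∝X′ᵢ Xⱼ∝X′ⱼ others) =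
      inj₂ (inj₂ (inj₂ (XᵢXⱼ , XᵢXⱼ-TLine , meet-in-line i≢j Xᵢ∝X′ᵢ Xⱼ∝X′ⱼ others)))
      where
      XᵢXⱼ : Line
      XᵢXⱼ = subsp (X i ∷ X j ∷ []) (LinIndep-pair independent i≢j)
      XᵢXⱼ-TLine : TLine Γ XᵢXⱼ
      XᵢXⱼ-TLine = i , j , i≢j , (X i , point≢0 i , ∈span-member (X i ∷ X j ∷ []) 0F , point∈Tr i)
                                , (X j , point≢0 j , ∈span-member (X i ∷ X j ∷ []) 1F , point∈Tr j)

    meet : TMeet P P′
    meet = classify (support {Q = λ i → X i ∝ X′ i} λ i → ∝? (X i) (X′≢0 i))

  T-planes-meet : ∀ {P P′} → TPlane Γ P → TPlane Γ P′ → TMeet P P′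
  T-planes-meet {P} {P′} tP tP′ = Intersection.meet {P} {P′} (frame tP) (frame tP′)

lemma3p3 : ∀ {c ℓ} (q : ℕ) → IsPrimePower q →
    (F : CommutativeRing c ℓ) → IsField F → HasSize F (q ^ 3) →
    let open PG8 F q in
    (Γ : Plane) → DisjointFromSubgeom Γ → ConjugatesSpan Γ →
    (P P′ : Plane) → TPlane Γ P → TPlane Γ P′ →
    SameSubsp P P′
    ⊎ Disjoint P P′
    ⊎ (∃[ p ] ∃[ pind ] (TPoint Γ p × IntersectionIs P P′ (subsp (pointOf p) pind)))
    ⊎ (∃[ L ] (TLine Γ L × IntersectionIs P P′ L))
lemma3p3 q (p , k , p-prime , _ , q≡pᵏ) F isField size Γ _ Γ-spanning P P′ tP tP′ = T-planes-meet {P} {P′} tP tP′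
  where
  open FiniteField F isField size using (_≟_; characteristic)
  open Conjugates F {k = k} p-prime q≡pᵏ using (Conj⇒∈span)
  q³≡p^[3k] : q ^ 3 ≡ p ^ (k ℕ.* 3)
  q³≡p^[3k] = ≡.trans (≡.cong (_^ 3) q≡pᵏ) (ℕ.^-*-assoc p k 3)
  open TPlanes F isField _≟_ q (Conj⇒∈span (characteristic {p} {k ℕ.* 3} q³≡p^[3k])) Γ Γ-spanning using (T-planes-meet)
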